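{- Assume the setting described in the context. Let $T$ and $T'$ be $t$-subsets of $X$. Then there exists $g\in G_\alpha$ such that $\Delta(T)^g=\Delta(T')$.
   Context: Graphs are finite, simple, connected, undirected. For a vertex $v$, $\Gamma_i(v)$ is the set of vertices at distance $i$ from $v$. The $v$-girth $\lambda_v(\Gamma)$ is the length of a shortest cycle through $v$; the local girth at $\alpha$ is $\lambda(\Gamma,\alpha)=\min(\{\lambda_\alpha(\Gamma)\}\cup\{\lambda_\beta(\Gamma)+1\mid\beta\in\Gamma_1(\alpha)\})$. A group acting on a set $Y$ is $t$-homogeneous if it is transitive on the $t$-subsets of $Y$. Setting: $\Gamma$ is a $k$-regular graph with $k\geqslant 3$, $G\leqslant\mathrm{Aut}(\Gamma)$, $\alpha\in V\Gamma$, $s\geqslant1$ with $\lambda(\Gamma,\alpha)\geqslant 2s+2$, $G_\alpha$ is transitive on $\Gamma_s(\alpha)$, and $\Delta$ is a $G_\alpha$-orbit contained in $\Gamma_{s+1}(\alpha)$. Let $c_s'=|\Gamma_1(\delta)\cap\Gamma_s(\alpha)|$ for $\delta\in\Delta$ (independent of $\delta$). Assume the action of $G_\alpha$ on $\Gamma_1(\alpha)$ is $t$-homogeneous for some integer $1\leqslant t\leqslant c_s'$. Write $\Gamma_1(\alpha)=\{\beta_1,\ldots,\beta_k\}$, $X=\{1,\ldots,k\}$, and for $S\subseteq X$ let $\Delta(S)=\Delta\cap\bigcap_{j\in S}\Gamma_s(\beta_j)$. -}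

module Defs where

open import Level using (0ℓ)
open import Data.Nat using (ℕ; zero; suc; _+_; _≤_; _<_)
open import Data.Fin using (Fin; toℕ)
open import Data.Fin.Permutation using (Permutation′; _⟨$⟩ʳ_; id; flip; _∘ₚ_)
open import Data.List using (List; length)
open import Data.List.Membership.Propositional using (_∈_)
open import Data.List.Relation.Unary.Unique.Propositional using (Unique)
open import Data.Product using (Σ; ∃; _×_; _,_)
open import Relation.Nullary using (¬_; Dec)
open import Relation.Binary.PropositionalEquality using (_≡_)
open import Function.Bundles using (_⇔_)

record Graph (n : ℕ) : Set₁ where
  field
    E      : Fin n → Fin n → Set
    E?     : ∀ u v → Dec (E u v)
    sym    : ∀ {u v} → E u v → E v u
    irrefl : ∀ {u} → ¬ E u u

module _ {n : ℕ} (Γ : Graph n) where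
  open Graph Γ

  data Walk : Fin n → Fin n → ℕ → Set where
    here : ∀ {u} → Walk u u 0
    step : ∀ {u w v m} → E u w → Walk w v m → Walk u v (suc m)

  Dist : Fin n → Fin n → ℕ → Set
  Dist u v i = Walk u v i × (∀ j → j < i → ¬ Walk u v j)

  Connected : Set
  Connected = ∀ u v → ∃ λ m → Walk u v m

  record Cycle (ℓ : ℕ) : Set where
    field
      len≥3  : 3 ≤ ℓ
      f      : Fin ℓ → Fin n
      inj    : ∀ i j → f i ≡ f j → i ≡ j
      adj    : ∀ (i j : Fin ℓ) → suc (toℕ i) ≡ toℕ j → E (f i) (f j)
      close  : ∀ (i j : Fin ℓ) → suc (toℕ i) ≡ ℓ → toℕ j ≡ 0 → E (f i) (f j)

  CycleThrough : Fin n → ℕ → Set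
  CycleThrough v ℓ = Σ (Cycle ℓ) λ C → ∃ λ i → Cycle.f C i ≡ v

  -- λ_v(Γ) ≥ g  (vacuous if there is no cycle through v, i.e. girth ∞)
  VGirth≥ : Fin n → ℕ → Set
  VGirth≥ v g = ∀ ℓ → CycleThrough v ℓ → g ≤ ℓ

  -- local girth λ(Γ,α) ≥ g, i.e. λ_α ≥ g and λ_β + 1 ≥ g for all neighbours β of α
  LocalGirth≥ : Fin n → ℕ → Set
  LocalGirth≥ α g = VGirth≥ α g × (∀ β → E α β → ∀ ℓ → CycleThrough β ℓ → g ≤ suc ℓ)

  IsAut : Permutation′ n → Set
  IsAut g = ∀ u v → E u v ⇔ E (g ⟨$⟩ʳ u) (g ⟨$⟩ʳ v)

HasSize : ∀ {n} → (Fin n → Set) → ℕ → Set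
HasSize {n} P c = Σ (List (Fin n)) λ L → Unique L × (∀ x → (x ∈ L) ⇔ P x) × length L ≡ c

record AutSubgroup {n : ℕ} (Γ : Graph n) : Set₁ where
  field
    In     : Permutation′ n → Set
    aut    : ∀ g → In g → IsAut Γ g
    has-id : In id
    comp   : ∀ g h → In g → In h → In (g ∘ₚ h)
    inv    : ∀ g → In g → In (flip g)

open import Data.Fin.Subset using (Subset) renaming (_∈_ to _∈ₛ_)

module _ {n : ℕ} {Γ : Graph n} (G : AutSubgroup Γ) where
  open AutSubgroup G

  Stab : Fin n → Permutation′ n → Set
  Stab α g = In g × g ⟨$⟩ʳ α ≡ α

  Orbit : Fin n → Fin n → Fin n → Set
  Orbit α δ₀ x = ∃ λ g → Stab α g × g ⟨$⟩ʳ δ₀ ≡ x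

  DeltaS : ∀ {k} → Fin n → Fin n → ℕ → (Fin k → Fin n) → Subset k → Fin n → Set
  DeltaS α δ₀ s β S x = Orbit α δ₀ x × (∀ j → j ∈ₛ S → Dist Γ (β j) x s)

  MapsOnto : ∀ {k} → (Fin k → Fin n) → Permutation′ n → Subset k → Subset k → Set
  MapsOnto β g S S' = (∀ j → j ∈ₛ S → ∃ λ j' → j' ∈ₛ S' × g ⟨$⟩ʳ β j ≡ β j')
                    × (∀ j' → j' ∈ₛ S' → ∃ λ j → j ∈ₛ S × g ⟨$⟩ʳ β j ≡ β j')

  ImageEq : Permutation′ n → (Fin n → Set) → (Fin n → Set) → Set
  ImageEq g P Q = (∀ x → P x → Q (g ⟨$⟩ʳ x)) × (∀ y → Q y → ∃ λ x → P x × g ⟨$⟩ʳ x ≡ y)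

module Submission where

-- By t-homogeneity there is g ∈ G_α mapping the set
-- {β_j | j ∈ T} onto {β_j | j ∈ T′}; we show that this g already maps Δ(T)
-- onto Δ(T′).  Two general facts make this work:
--   * automorphisms preserve walks, hence distances (the inverse of an
--     automorphism is again one, so shorter walks cannot appear);
--   * the stabiliser G_α is a subgroup, so it preserves its own orbit Δ.
-- Consequently, if every β_{j′} (j′ ∈ S′) is the g-image of some β_j (j ∈ S),
-- then g sends Δ(S) into Δ(S′).  Applying this to g with (T, T′) and to g⁻¹
-- with (T′, T) gives both inclusions of the image equation g(Δ(T)) = Δ(T′).

open import Defs
open import Data.Nat using (ℕ; suc; _+_; _*_; _≤_)
open import Data.Fin using (Fin)
open import Data.Fin.Subset using (Subset; ∣_∣) renaming (_∈_ to _∈ₛ_)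
open import Data.Fin.Permutation
  using (Permutation′; _⟨$⟩ʳ_; _⟨$⟩ˡ_; flip; _∘ₚ_; inverseˡ; inverseʳ)
open import Data.Product using (∃; _×_; _,_; proj₁)
open import Function.Bundles using (Equivalence)
open import Relation.Binary.PropositionalEquality
  using (_≡_; refl; sym; trans; cong; subst; subst₂)

module _ {n : ℕ} (Γ : Graph n) where

  aut-inverse : (h : Permutation′ n) → IsAut Γ h → IsAut Γ (flip h)
  aut-inverse h a u v = record
    { to        = λ e → Equivalence.from (a (h ⟨$⟩ˡ u) (h ⟨$⟩ˡ v))
                          (subst₂ (Graph.E Γ) (sym (inverseʳ h)) (sym (inverseʳ h)) e)
    ; from      = λ e → subst₂ (Graph.E Γ) (inverseʳ h) (inverseʳ h)
                          (Equivalence.to (a (h ⟨$⟩ˡ u) (h ⟨$⟩ˡ v)) e)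
    ; to-cong   = λ { refl → refl }
    ; from-cong = λ { refl → refl }
    }

  walk-image : (h : Permutation′ n) → IsAut Γ h
    → ∀ {u v m} → Walk Γ u v m → Walk Γ (h ⟨$⟩ʳ u) (h ⟨$⟩ʳ v) m
  walk-image h a here                 = here
  walk-image h a (step {u} {w} e walk) = step (Equivalence.to (a u w) e) (walk-image h a walk)

  walk-preimage : (h : Permutation′ n) → IsAut Γ h
    → ∀ {u v m} → Walk Γ (h ⟨$⟩ʳ u) (h ⟨$⟩ʳ v) m → Walk Γ u v m
  walk-preimage h a {m = m} walk =
    subst₂ (λ x y → Walk Γ x y m) (inverseˡ h) (inverseˡ h)
      (walk-image (flip h) (aut-inverse h a) walk)

  dist-image : (h : Permutation′ n) → IsAut Γ h
    → ∀ {u v i} → Dist Γ u v i → Dist Γ (h ⟨$⟩ʳ u) (h ⟨$⟩ʳ v) i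
  dist-image h a (walk , noShorter) =
    walk-image h a walk , λ j j<i walk′ → noShorter j j<i (walk-preimage h a walk′)

module _ {n : ℕ} {Γ : Graph n} (G : AutSubgroup Γ) (α : Fin n) where
  open AutSubgroup G

  stab-comp : ∀ g h → Stab G α g → Stab G α h → Stab G α (g ∘ₚ h)
  stab-comp g h (gIn , gα) (hIn , hα) =
    comp g h gIn hIn , trans (cong (h ⟨$⟩ʳ_) gα) hα

  stab-inv : ∀ g → Stab G α g → Stab G α (flip g)
  stab-inv g (gIn , gα) = inv g gIn , trans (cong (g ⟨$⟩ˡ_) (sym gα)) (inverseˡ g)

  orbit-closed : ∀ δ₀ g x → Stab G α g → Orbit G α δ₀ x → Orbit G α δ₀ (g ⟨$⟩ʳ x)
  orbit-closed δ₀ g x gStab (h , hStab , hδ₀) =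
    h ∘ₚ g , stab-comp h g hStab gStab , cong (g ⟨$⟩ʳ_) hδ₀

  deltaS-image : ∀ {k} δ₀ s (β : Fin k → Fin n) (S S′ : Subset k) g → Stab G α g
    → (∀ j′ → j′ ∈ₛ S′ → ∃ λ j → j ∈ₛ S × g ⟨$⟩ʳ β j ≡ β j′)
    → ∀ x → DeltaS G α δ₀ s β S x → DeltaS G α δ₀ s β S′ (g ⟨$⟩ʳ x)
  deltaS-image δ₀ s β S S′ g gStab covers x (x∈Δ , dists) =
    orbit-closed δ₀ g x gStab x∈Δ , λ j′ j′∈S′ →
      let (j , j∈S , gβj≡βj′) = covers j′ j′∈S′
      in subst (λ b → Dist Γ b (g ⟨$⟩ʳ x) s) gβj≡βj′
           (dist-image Γ g (aut g (proj₁ gStab)) (dists j j∈S))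

  mapsOnto-inverse : ∀ {k} (β : Fin k → Fin n) g (S S′ : Subset k)
    → (∀ j → j ∈ₛ S → ∃ λ j′ → j′ ∈ₛ S′ × g ⟨$⟩ʳ β j ≡ β j′)
    → ∀ j → j ∈ₛ S → ∃ λ j′ → j′ ∈ₛ S′ × flip g ⟨$⟩ʳ β j′ ≡ β j
  mapsOnto-inverse β g S S′ hits j j∈S =
    let (j′ , j′∈S′ , gβj≡βj′) = hits j j∈S
    in j′ , j′∈S′ , trans (cong (g ⟨$⟩ˡ_) (sym gβj≡βj′)) (inverseˡ g)

  deltaS-imageEq : ∀ {k} δ₀ s (β : Fin k → Fin n) (S S′ : Subset k) g → Stab G α g
    → MapsOnto G β g S S′
    → ImageEq G g (DeltaS G α δ₀ s β S) (DeltaS G α δ₀ s β S′)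
  deltaS-imageEq δ₀ s β S S′ g gStab (hits , covers) =
    deltaS-image δ₀ s β S S′ g gStab covers ,
    λ y y∈ΔS′ →
      g ⟨$⟩ˡ y ,
      deltaS-image δ₀ s β S′ S (flip g) (stab-inv g gStab)
        (mapsOnto-inverse β g S S′ hits) y y∈ΔS′ ,
      inverseʳ g

lemma3p5 : ∀ {n} (Γ : Graph n) (G : AutSubgroup Γ) (k : ℕ) → 3 ≤ k
    → Connected Γ → (∀ v → HasSize (Graph.E Γ v) k)
    → (α : Fin n) (s : ℕ) → 1 ≤ s → LocalGirth≥ Γ α (2 * s + 2)
    → (∀ x y → Dist Γ α x s → Dist Γ α y s → ∃ λ g → Stab G α g × g ⟨$⟩ʳ x ≡ y)
    → (δ₀ : Fin n) → Dist Γ α δ₀ (suc s)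
    → (β : Fin k → Fin n) → (∀ i j → β i ≡ β j → i ≡ j)
    → (∀ j → Graph.E Γ α (β j)) → (∀ v → Graph.E Γ α v → ∃ λ j → β j ≡ v)
    → (c t : ℕ) → HasSize (λ x → Graph.E Γ δ₀ x × Dist Γ α x s) c
    → 1 ≤ t → t ≤ c
    → (∀ (T T′ : Subset k) → ∣ T ∣ ≡ t → ∣ T′ ∣ ≡ t → ∃ λ g → Stab G α g × MapsOnto G β g T T′)
    → ∀ (T T′ : Subset k) → ∣ T ∣ ≡ t → ∣ T′ ∣ ≡ t
    → ∃ λ g → Stab G α g × ImageEq G g (DeltaS G α δ₀ s β T) (DeltaS G α δ₀ s β T′)
lemma3p5 _ G _ _ _ _ α s _ _ _ δ₀ _ β _ _ _ _ _ _ _ _ homogeneous T T′ ∣T∣ ∣T′∣ =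
  let (g , gStab , gMapsOnto) = homogeneous T T′ ∣T∣ ∣T′∣
  in g , gStab , deltaS-imageEq G α δ₀ s β T T′ g gStab gMapsOnto
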